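{- Let $n_s\neq n_t$ be nodes, let $\rho^{FS}$ be a fastest simplest route in the road network from $n_s$ to $n_t$, and let $\rho_{\mathcal{E}}^{FS*}$ be its special expanded route. Then there is no expanded route that starts at $(n_s,r_i)$ and ends at $(n_t,r_j)$, for any $r_i\in R(n_s)$ and $r_j\in R(n_t)$, which is FS-shorter than $\rho_{\mathcal{E}}^{FS*}$.
   Context: Let $V$ be a finite set of nodes. A road is a finite sequence of distinct nodes of $V$. Let $R$ be a finite set of roads such that every node lies on at least one road and any pair of consecutive nodes of some road does not appear (as consecutive nodes) in any other road. For $n\in V$, $R(n)$ is the set of roads containing $n$. The road network $G_R=(V,E)$ is the directed graph with an edge $(n_i,n_j)$ whenever $n_i,n_j$ are consecutive nodes of some road; $R(n_i,n_j)$ denotes the unique road containing this segment. A length function $L:E\to\mathbb{R}^+$ is given. The turn cost is $C(n,r,r')=1$ if $r\neq r'$ and $C(n,r,r)=0$ ($r,r'\in R(n)$). A route is a sequence of nodes $\rho=(n_1,\dots,n_k)$ with $(n_m,n_{m+1})\in E$; its length is $L(\rho)=\sum_{m=1}^{k-1}L(n_m,n_{m+1})$ and its complexity is $C(\rho)=\sum_{m=2}^{k-1}C(n_m,R(n_{m-1},n_m),R(n_m,n_{m+1}))$. A simplest route from $n_s$ to $n_t$ is one of minimum complexity among routes from $n_s$ to $n_t$; a fastest simplest route is one of minimum length among all simplest routes from $n_s$ to $n_t$. The expanded graph $G_{\mathcal{E}}$ has expanded nodes $(n,r)$ with $r\in R(n)$ and an edge $((n_x,r_i),(n_y,r_j))$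 whenever $r_i,r_j\in R(n_x)$ ($r_i=r_j$ allowed) and $n_x,n_y$ are consecutive nodes of $r_j$. An expanded route $((n_1,r_1),\dots,(n_k,r_k))$ is a path in $G_{\mathcal{E}}$, with length $\sum_{m=1}^{k-1}L(n_m,n_{m+1})$ and complexity $\sum_{m=1}^{k-1}C(n_m,r_m,r_{m+1})$. For a route $\rho=(n_1,\dots,n_k)$, $k\ge2$, its special expanded route is $((n_1,R(n_1,n_2)),(n_2,R(n_1,n_2)),(n_3,R(n_2,n_3)),\dots,(n_k,R(n_{k-1},n_k)))$. For two (expanded) routes, $\rho^1$ is FS-shorter than $\rho^2$ if $C(\rho^1)<C(\rho^2)$, or $C(\rho^1)=C(\rho^2)$ and $L(\rho^1)<L(\rho^2)$.
   Formalization: The length function L takes values in the positive rationals instead of ℝ⁺. -}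

module Defs where

open import Data.Nat using (ℕ; zero; suc; _+_)
import Data.Nat as ℕ
open import Data.Fin using (Fin; _≟_)
open import Data.List using (List; []; _∷_; _++_)
open import Data.List.Membership.Propositional using (_∈_)
open import Data.List.Membership.Propositional.Properties using (∈-++⁺ʳ)
open import Data.List.Relation.Unary.Any using (here; there)
open import Data.List.Relation.Unary.Unique.Propositional using (Unique)
open import Data.Product using (Σ; ∃; ∃₂; _×_; _,_; proj₁)
open import Data.Sum using (_⊎_)
open import Data.Bool using (if_then_else_)
open import Data.Rational using (ℚ; Positive) renaming (_+_ to _+ℚ_; _<_ to _<ℚ_; _≤_ to _≤ℚ_)
import Data.Rational as ℚ
open import Relation.Nullary.Decidable using (⌊_⌋)
open import Relation.Binary.PropositionalEquality using (_≡_; refl; subst; sym)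

Consec : {N : ℕ} → Fin N → Fin N → List (Fin N) → Set
Consec a b l = ∃₂ λ xs ys → l ≡ xs ++ (a ∷ b ∷ ys)

record RoadSystem (N : ℕ) : Set where
  field
    M              : ℕ
    road           : Fin M → List (Fin N)
    road-distinct  : ∀ r → Unique (road r)
    road-injective : ∀ r r' → road r ≡ road r' → r ≡ r'     -- R is a set
    covers         : ∀ (n : Fin N) → ∃ λ r → n ∈ road r
    segment-unique : ∀ r r' (a b : Fin N) →
                     Consec a b (road r) → Consec a b (road r') → r ≡ r'

module _ {N : ℕ} (S : RoadSystem N) where
  open RoadSystem S

  -- an edge (a,b) of G_R, together with the (unique) road R(a,b) containing it
  Edge : Fin N → Fin N → Set
  Edge a b = Σ (Fin M) λ r → Consec a b (road r)

  segRoad : {a b : Fin N} → Edge a b → Fin M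
  segRoad = proj₁

  -- turn cost C(n,r,r') (independent of n)
  turn : Fin M → Fin M → ℕ
  turn r r' = if ⌊ r ≟ r' ⌋ then 0 else 1

  -- a route (n_1,...,n_k), k ≥ 2, given by its consecutive edges
  data Route : Fin N → Fin N → Set where
    edge : {a b : Fin N} → Edge a b → Route a b
    _∷_  : {a b c : Fin N} → Edge a b → Route b c → Route a c

  firstRoad : {a b : Fin N} → Route a b → Fin M
  firstRoad (edge e) = segRoad e
  firstRoad (e ∷ _)  = segRoad e

  lastRoad : {a b : Fin N} → Route a b → Fin M
  lastRoad (edge e) = segRoad e
  lastRoad (_ ∷ ρ)  = lastRoad ρ

  complexity : {a b : Fin N} → Route a b → ℕ
  complexity (edge e) = 0
  complexity (e ∷ ρ)  = turn (segRoad e) (firstRoad ρ) + complexity ρ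

  module _ (L : Fin N → Fin N → ℚ) where
    len : {a b : Fin N} → Route a b → ℚ
    len {a} {b} (edge e)     = L a b
    len {a} (_∷_ {b = b} e ρ) = L a b +ℚ len ρ

  IsSimplest : {a b : Fin N} → Route a b → Set
  IsSimplest {a} {b} ρ = ∀ (ρ' : Route a b) → complexity ρ ℕ.≤ complexity ρ'

  IsFastestSimplest : (L : Fin N → Fin N → ℚ) → {a b : Fin N} → Route a b → Set
  IsFastestSimplest L {a} {b} ρ =
    IsSimplest ρ × (∀ (ρ' : Route a b) → IsSimplest ρ' → len L ρ ≤ℚ len L ρ')

  -- expanded routes ((n_1,r_1),...,(n_k,r_k)) in G_E, k ≥ 1;
  -- each expanded node (n,r) satisfies r ∈ R(n); an expanded edge
  -- ((n,r),(n',r')) requires r,r' ∈ R(n) and n,n' consecutive on r'.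
  data ERoute : Fin N → Fin M → Fin N → Fin M → Set where
    enil  : {n : Fin N} {r : Fin M} → n ∈ road r → ERoute n r n r
    econs : {n n' n'' : Fin N} {r r' r'' : Fin M} →
            n ∈ road r → Consec n n' (road r') →
            ERoute n' r' n'' r'' → ERoute n r n'' r''

  ecomplexity : {n n' : Fin N} {r r' : Fin M} → ERoute n r n' r' → ℕ
  ecomplexity (enil _) = 0
  ecomplexity (econs {r = r} {r' = r'} _ _ ρ) = turn r r' + ecomplexity ρ

  elen : (L : Fin N → Fin N → ℚ) → {n n' : Fin N} {r r' : Fin M} → ERoute n r n' r' → ℚ
  elen L (enil _) = 0ℚ where open Data.Rational using (0ℚ)
  elen L (econs {n = n} {n' = n'} _ _ ρ) = L n n' +ℚ elen L ρ

  private
    fst∈ : {a b : Fin N} {l : List (Fin N)} → Consec a b l → a ∈ l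
    fst∈ (xs , ys , refl) = ∈-++⁺ʳ xs (here refl)
    snd∈ : {a b : Fin N} {l : List (Fin N)} → Consec a b l → b ∈ l
    snd∈ (xs , ys , refl) = ∈-++⁺ʳ xs (there (here refl))

    spec : {a b : Fin N} (r : Fin M) → a ∈ road r → (ρ : Route a b) → ERoute a r b (lastRoad ρ)
    spec r m (edge (r' , c)) = econs m c (enil (snd∈ c))
    spec r m ((r' , c) ∷ ρ)  = econs m c (spec r' (snd∈ c) ρ)

  -- the special expanded route of ρ:
  -- ((n_1,R(n_1,n_2)),(n_2,R(n_1,n_2)),(n_3,R(n_2,n_3)),...,(n_k,R(n_{k-1},n_k)))
  special : {a b : Fin N} (ρ : Route a b) → ERoute a (firstRoad ρ) b (lastRoad ρ)
  special (edge (r , c)) = spec r (fst∈ c) (edge (r , c))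
  special ((r , c) ∷ ρ)  = spec r (fst∈ c) ((r , c) ∷ ρ)

  FSShorter : (L : Fin N → Fin N → ℚ) →
              {a b a' b' : Fin N} {r s r' s' : Fin M} →
              ERoute a r b s → ERoute a' r' b' s' → Set
  FSShorter L ρ₁ ρ₂ =
    ecomplexity ρ₁ ℕ.< ecomplexity ρ₂ ⊎
    (ecomplexity ρ₁ ≡ ecomplexity ρ₂ × elen L ρ₁ <ℚ elen L ρ₂)

{-# OPTIONS --safe #-}
module Submission where

-- An expanded route (n₁,r₁),…,(n_k,r_k) with k ≥ 2 is a route n₁,…,n_k together with a
-- starting road r₁: every later r_m is forced to be the road of the segment entering n_m.
-- Hence its length is that of the route, and its complexity is the route's complexity plus
-- the turn from r₁ onto the first segment, so it is never FS-shorter than its projection.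
-- The special expanded route of a route ρ starts on ρ's first road, so it has exactly the
-- complexity and length of ρ; being FS-shorter than it would make the projection beat ρ.

open import Defs
open import Data.Nat using (ℕ; _+_; _≤_; _<_)
open import Data.Nat.Properties using (<⇒≱; m≤n+m; ≤-reflexive; ≤-trans; ≤-<-trans)
open import Data.Fin using (Fin; _≟_)
open import Data.Rational using (ℚ; Positive)
import Data.Rational as ℚ
import Data.Rational.Properties as ℚ
open import Data.Product using (_,_; _×_)
open import Data.Sum using (_⊎_; inj₁; inj₂)
open import Data.List.Membership.Propositional using (_∈_)
open import Relation.Nullary using (¬_; yes; no)
open import Relation.Nullary.Negation using (contradiction)
open import Relation.Binary.PropositionalEquality
  using (_≡_; _≢_; refl; sym; trans; cong; subst; subst₂)

module _ {N : ℕ} (S : RoadSystem N) where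
  open RoadSystem S

  turn-refl : (r : Fin M) → turn S r r ≡ 0
  turn-refl r with r ≟ r
  ... | yes _   = refl
  ... | no r≢r = contradiction refl r≢r

  -- special unfolds through a private helper, so it is peeled off one segment at a time.
  ecomplexity-special-∷ : {a b c : Fin N} (e : Edge S a b) (ρ : Route S b c) →
    ecomplexity S (special S (e ∷ ρ)) ≡ turn S (segRoad S e) (firstRoad S ρ) + ecomplexity S (special S ρ)
  ecomplexity-special-∷ (r , _) (edge (r′ , _)) rewrite turn-refl r | turn-refl r′ = refl
  ecomplexity-special-∷ (r , _) ((r′ , _) ∷ _)  rewrite turn-refl r | turn-refl r′ = refl

  ecomplexity-special : {a b : Fin N} (ρ : Route S a b) → ecomplexity S (special S ρ) ≡ complexity S ρ
  ecomplexity-special (edge (r , _)) rewrite turn-refl r = refl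
  ecomplexity-special (e ∷ ρ) =
    trans (ecomplexity-special-∷ e ρ) (cong (turn S (segRoad S e) (firstRoad S ρ) +_) (ecomplexity-special ρ))

  project : {a a′ b : Fin N} {r s : Fin M} → Consec a a′ (road r) → ERoute S a′ r b s → Route S a b
  project {r = r} c (enil _)       = edge (r , c)
  project {r = r} c (econs _ c′ τ) = (r , c) ∷ project c′ τ

  firstRoad-project : {a a′ b : Fin N} {r s : Fin M} (c : Consec a a′ (road r)) (τ : ERoute S a′ r b s) →
    firstRoad S (project c τ) ≡ r
  firstRoad-project c (enil _)      = refl
  firstRoad-project c (econs _ _ _) = refl

  complexity-project : {a a′ b : Fin N} {r s : Fin M} (c : Consec a a′ (road r)) (τ : ERoute S a′ r b s) →
    complexity S (project c τ) ≡ ecomplexity S τ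
  complexity-project c (enil _) = refl
  complexity-project {r = r} c (econs _ c′ τ) rewrite firstRoad-project c′ τ =
    cong (turn S r _ +_) (complexity-project c′ τ)

  complexity-project-≤ : {a a′ b : Fin N} {r₀ r s : Fin M} (m : a ∈ road r₀) (c : Consec a a′ (road r))
    (τ : ERoute S a′ r b s) → complexity S (project c τ) ≤ ecomplexity S (econs m c τ)
  complexity-project-≤ {r₀ = r₀} {r} _ c τ =
    ≤-trans (≤-reflexive (complexity-project c τ)) (m≤n+m (ecomplexity S τ) (turn S r₀ r))

  module _ (L : Fin N → Fin N → ℚ) where

    elen-special-∷ : {a b c : Fin N} (e : Edge S a b) (ρ : Route S b c) →
      elen S L (special S (e ∷ ρ)) ≡ L a b ℚ.+ elen S L (special S ρ)
    elen-special-∷ _ (edge _) = refl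
    elen-special-∷ _ (_ ∷ _)  = refl

    elen-special : {a b : Fin N} (ρ : Route S a b) → elen S L (special S ρ) ≡ len S L ρ
    elen-special (edge _)           = ℚ.+-identityʳ _
    elen-special (_∷_ {a} {b} e ρ) = trans (elen-special-∷ e ρ) (cong (L a b ℚ.+_) (elen-special ρ))

    len-project : {a a′ b : Fin N} {r₀ r s : Fin M} (m : a ∈ road r₀) (c : Consec a a′ (road r))
      (τ : ERoute S a′ r b s) → len S L (project c τ) ≡ elen S L (econs m c τ)
    len-project _ c (enil _)                 = sym (ℚ.+-identityʳ _)
    len-project {a} {a′} _ c (econs m′ c′ τ) = cong (L a a′ ℚ.+_) (len-project m′ c′ τ)

    Beats : {a b : Fin N} → Route S a b → Route S a b → Set
    Beats ρ′ ρ = complexity S ρ′ < complexity S ρ ⊎ (complexity S ρ′ ≤ complexity S ρ × len S L ρ′ ℚ.< len S L ρ)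

    fastestSimplest-unbeaten : {a b : Fin N} (ρ : Route S a b) → IsFastestSimplest S L ρ →
      (ρ′ : Route S a b) → ¬ Beats ρ′ ρ
    fastestSimplest-unbeaten _ (simplest , _) ρ′ (inj₁ fewer) = <⇒≱ fewer (simplest ρ′)
    fastestSimplest-unbeaten _ (simplest , fastest) ρ′ (inj₂ (no-more , shorter)) =
      ℚ.<-irrefl refl (ℚ.<-≤-trans shorter (fastest ρ′ ρ′-simplest))
      where
      ρ′-simplest : IsSimplest S ρ′
      ρ′-simplest ρ″ = ≤-trans no-more (simplest ρ″)

    project-beats : {a a′ b : Fin N} {r₀ r s : Fin M} (m : a ∈ road r₀) (c : Consec a a′ (road r))
      (τ : ERoute S a′ r b s) (ρ : Route S a b) →
      FSShorter S L (econs m c τ) (special S ρ) → Beats (project c τ) ρ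
    project-beats m c τ ρ (inj₁ fewer) =
      inj₁ (≤-<-trans (complexity-project-≤ m c τ) (subst (_ <_) (ecomplexity-special ρ) fewer))
    project-beats m c τ ρ (inj₂ (same , shorter)) =
      inj₂ ( ≤-trans (complexity-project-≤ m c τ) (≤-reflexive (trans same (ecomplexity-special ρ)))
           , subst₂ ℚ._<_ (sym (len-project m c τ)) (elen-special ρ) shorter )

theorem1 : (N : ℕ) (S : RoadSystem N) (L : Fin N → Fin N → ℚ) →
    (∀ (a b : Fin N) → Edge S a b → Positive (L a b)) →
    (ns nt : Fin N) → ns ≢ nt →
    (ρFS : Route S ns nt) → IsFastestSimplest S L ρFS →
    ∀ (ri rj : Fin (RoadSystem.M S)) (ρ : ERoute S ns ri nt rj) →
    ¬ FSShorter S L ρ (special S ρFS)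
theorem1 N S L _ ns nt ns≢nt ρFS fastest-simplest ri rj (enil _) _ = ns≢nt refl
theorem1 N S L _ ns nt ns≢nt ρFS fastest-simplest ri rj (econs m c τ) shorter =
  fastestSimplest-unbeaten S L ρFS fastest-simplest (project S c τ) (project-beats S L m c τ ρFS shorter)
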